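{- Let $d\ge 3$ be an integer and let $G$ be a finite graph. Then $G$ admits an $H_d$-flow if and only if $G$ admits an oriented $d$-cycle double cover.
   Context: $H_d$ is the set of vectors in $\mathbb{R}^d$ with integer coordinates, exactly one coordinate equal to $1$, exactly one equal to $-1$ and all others $0$ (equivalently $H_d=\{x\in\mathbb{Z}^d:\sum_i x_i=0,\ \sum_i x_i^2=2\}$). For a set $X\subseteq\mathbb{R}^d$, an $X$-flow on $G$ is an orientation $O$ of $G$ together with a map $\varphi:E(G)\to X$ such that at every vertex $v$ the sum of $\varphi(e)$ over edges directed out of $v$ equals the sum of $\varphi(e)$ over edges directed into $v$. A cycle of $G$ is a subgraph in which every vertex has even degree; given an orientation $O_i$ of a cycle $C_i$, $O_i(C_i)$ is a directed cycle if at every vertex of $C_i$ the indegree equals the outdegree. An oriented $d$-cycle double cover of $G$ is a collection $\{O_1(C_1),\dots,O_d(C_d)\}$ of $d$ directed cycles of $G$ such that every edge of $G$ lies in exactly two of the cycles $C_i,C_j$ and the orientations $O_i$ and $O_j$ are opposite on that edge. -}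

module Defs where

open import Data.Nat using (ℕ; zero; suc)
import Data.Nat as ℕ
open import Data.Integer using (ℤ; +_; -_; 0ℤ; 1ℤ; -1ℤ)
import Data.Integer as ℤ
open import Data.Fin using (Fin; zero; suc; _≟_)
open import Data.Bool using (Bool; true; false; if_then_else_; T; not)
open import Data.Product using (Σ; _×_; _,_; proj₁; proj₂; ∃-syntax)
open import Data.Sum using (_⊎_)
open import Relation.Nullary using (¬_)
open import Relation.Nullary.Decidable using (⌊_⌋)
open import Relation.Binary.PropositionalEquality using (_≡_; _≢_)

-- A finite (multi)graph: vertices Fin n, edges Fin m; each edge has two
-- (unordered in meaning) ends; loops (both ends equal) and parallel edges allowed.
record Graph : Set where
  field
    n   : ℕ
    m   : ℕ
    ends : Fin m → Fin n × Fin n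

open Graph public

Orientation : Graph → Set
Orientation G = Fin (m G) → Bool

tail : (G : Graph) → Orientation G → Fin (m G) → Fin (n G)
tail G O e = if O e then proj₁ (ends G e) else proj₂ (ends G e)

head : (G : Graph) → Orientation G → Fin (m G) → Fin (n G)
head G O e = if O e then proj₂ (ends G e) else proj₁ (ends G e)

sumℤ : (k : ℕ) → (Fin k → ℤ) → ℤ
sumℤ zero f = 0ℤ
sumℤ (suc k) f = f zero ℤ.+ sumℤ k (λ i → f (suc i))

sumℕ : (k : ℕ) → (Fin k → ℕ) → ℕ
sumℕ zero f = 0
sumℕ (suc k) f = f zero ℕ.+ sumℕ k (λ i → f (suc i))

Vecℤ : ℕ → Set
Vecℤ d = Fin d → ℤ

InH : (d : ℕ) → Vecℤ d → Set
InH d x = Σ (Fin d) λ i → Σ (Fin d) λ j →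
  i ≢ j × x i ≡ 1ℤ × x j ≡ -1ℤ × (∀ k → k ≢ i → k ≢ j → x k ≡ 0ℤ)

record Flow (G : Graph) (d : ℕ) (X : Vecℤ d → Set) : Set where
  field
    orient : Orientation G
    φ      : Fin (m G) → Vecℤ d
    φ∈X    : ∀ e → X (φ e)
    conserve : ∀ (v : Fin (n G)) (c : Fin d) →
      sumℤ (m G) (λ e → if ⌊ tail G orient e ≟ v ⌋ then φ e c else 0ℤ)
        ≡ sumℤ (m G) (λ e → if ⌊ head G orient e ≟ v ⌋ then φ e c else 0ℤ)

HFlow : Graph → ℕ → Set
HFlow G d = Flow G d (InH d)

EdgeSet : Graph → Set
EdgeSet G = Fin (m G) → Bool

-- degree of v in the edge set C (a loop contributes 2)
degree : (G : Graph) → EdgeSet G → Fin (n G) → ℕ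
degree G C v = sumℕ (m G) λ e → if C e
  then ((if ⌊ proj₁ (ends G e) ≟ v ⌋ then 1 else 0)
        ℕ.+ (if ⌊ proj₂ (ends G e) ≟ v ⌋ then 1 else 0))
  else 0

IsCycle : (G : Graph) → EdgeSet G → Set
IsCycle G C = ∀ v → Σ ℕ λ k → degree G C v ≡ k ℕ.+ k

outdeg indeg : (G : Graph) → EdgeSet G → Orientation G → Fin (n G) → ℕ
outdeg G C O v = sumℕ (m G) λ e →
  if C e then (if ⌊ tail G O e ≟ v ⌋ then 1 else 0) else 0
indeg G C O v = sumℕ (m G) λ e →
  if C e then (if ⌊ head G O e ≟ v ⌋ then 1 else 0) else 0

IsDirectedCycle : (G : Graph) → EdgeSet G → Orientation G → Set
IsDirectedCycle G C O = IsCycle G C × (∀ v → indeg G C O v ≡ outdeg G C O v)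

record OrientedCDC (G : Graph) (d : ℕ) : Set where
  field
    C : Fin d → EdgeSet G
    O : Fin d → Orientation G
    directed : ∀ i → IsDirectedCycle G (C i) (O i)
    cover : ∀ (e : Fin (m G)) → Σ (Fin d) λ i → Σ (Fin d) λ j →
      i ≢ j × T (C i e) × T (C j e) × O i e ≡ not (O j e) ×
      (∀ k → T (C k e) → k ≡ i ⊎ k ≡ j)

-- Read coordinatewise, an H_d-flow is d integer flows with values in {1, -1, 0}
-- whose supports cover every edge exactly twice, once with +1 and once with -1.
-- Reversing an edge and negating its value preserves conservation, so the k-th
-- coordinate becomes the indicator of its support, oriented along the edges
-- carrying +1 and against those carrying -1: a directed cycle. Conversely the k-th
-- coordinate of the flow is ±1 on the edges of the k-th directed cycle, with the
-- sign recording whether it agrees with a fixed reference orientation.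
module Submission where

open import Defs
open import Data.Nat using (ℕ; _≤_; zero; suc)
import Data.Nat as ℕ
import Data.Nat.Properties as ℕP
open import Data.Integer using (ℤ; +_; -_; _+_; 0ℤ; 1ℤ; -1ℤ)
import Data.Integer.Properties as ℤP
open import Data.Fin using (Fin; zero; suc; _≟_)
open import Data.Bool using (Bool; true; false; if_then_else_; T; not)
open import Data.Bool.Properties using (not-involutive)
open import Data.Product using (Σ; _×_; _,_; proj₁; proj₂)
open import Data.Sum using (_⊎_; inj₁; inj₂; [_,_])
open import Function using (_∘_)
open import Data.Empty using (⊥-elim)
open import Relation.Nullary using (¬_; yes; no)
open import Relation.Nullary.Decidable using (⌊_⌋)
open import Relation.Binary.PropositionalEquality
  using (_≡_; _≢_; refl; sym; trans; cong; cong₂; subst; module ≡-Reasoning)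
open import Algebra.Properties.AbelianGroup ℤP.+-0-abelianGroup using (∙-cancelʳ)
open import Algebra.Properties.CommutativeSemigroup ℤP.+-commutativeSemigroup
  using (interchange)
open import Algebra.Properties.CommutativeSemigroup ℕP.+-commutativeSemigroup
  using () renaming (interchange to ℕ-interchange)

sumℤ-cong : ∀ k {f g : Fin k → ℤ} → (∀ e → f e ≡ g e) → sumℤ k f ≡ sumℤ k g
sumℤ-cong zero    f≗g = refl
sumℤ-cong (suc k) f≗g = cong₂ _+_ (f≗g zero) (sumℤ-cong k (λ e → f≗g (suc e)))

sumℕ-cong : ∀ k {f g : Fin k → ℕ} → (∀ e → f e ≡ g e) → sumℕ k f ≡ sumℕ k g
sumℕ-cong zero    f≗g = refl
sumℕ-cong (suc k) f≗g = cong₂ ℕ._+_ (f≗g zero) (sumℕ-cong k (λ e → f≗g (suc e)))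

sumℤ-distrib-+ : ∀ k (f g : Fin k → ℤ) →
  sumℤ k (λ e → f e + g e) ≡ sumℤ k f + sumℤ k g
sumℤ-distrib-+ zero    f g = refl
sumℤ-distrib-+ (suc k) f g =
  trans (cong (λ s → f zero + g zero + s) (sumℤ-distrib-+ k _ _))
        (interchange (f zero) (g zero) _ _)

sumℕ-distrib-+ : ∀ k (f g : Fin k → ℕ) →
  sumℕ k (λ e → f e ℕ.+ g e) ≡ sumℕ k f ℕ.+ sumℕ k g
sumℕ-distrib-+ zero    f g = refl
sumℕ-distrib-+ (suc k) f g =
  trans (cong (f zero ℕ.+ g zero ℕ.+_) (sumℕ-distrib-+ k _ _))
        (ℕ-interchange (f zero) (g zero) _ _)

+-sumℕ : ∀ k (f : Fin k → ℕ) → + sumℕ k f ≡ sumℤ k (λ e → + f e)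
+-sumℕ zero    f = refl
+-sumℕ (suc k) f = cong (λ s → + f zero + s) (+-sumℕ k _)

sumℤ-pairwise : ∀ k {f g h l : Fin k → ℤ} → (∀ e → f e + g e ≡ h e + l e) →
  sumℤ k f + sumℤ k g ≡ sumℤ k h + sumℤ k l
sumℤ-pairwise k {f} {g} {h} {l} eq =
  trans (sym (sumℤ-distrib-+ k f g)) (trans (sumℤ-cong k eq) (sumℤ-distrib-+ k h l))

only-at : ∀ {n} → Fin n → Fin n → ℤ → ℤ
only-at u v x = if ⌊ u ≟ v ⌋ then x else 0ℤ

only-at-inverseˡ : ∀ {n} (u v : Fin n) x → only-at u v (- x) + only-at u v x ≡ 0ℤ
only-at-inverseˡ u v x with u ≟ v
... | yes _ = ℤP.+-inverseˡ x
... | no  _ = refl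

only-at-inverseʳ : ∀ {n} (u v : Fin n) x → only-at u v x + only-at u v (- x) ≡ 0ℤ
only-at-inverseʳ u v x with u ≟ v
... | yes _ = ℤP.+-inverseʳ x
... | no  _ = refl

flowOut flowIn : (G : Graph) → Orientation G → (Fin (m G) → ℤ) → Fin (n G) → ℤ
flowOut G O f v = sumℤ (m G) λ e → only-at (tail G O e) v (f e)
flowIn  G O f v = sumℤ (m G) λ e → only-at (head G O e) v (f e)

Balanced : (G : Graph) → Orientation G → (Fin (m G) → ℤ) → Set
Balanced G O f = ∀ v → flowOut G O f v ≡ flowIn G O f v

data Reorientation (o : Bool) (x : ℤ) : Bool → ℤ → Set where
  keep : Reorientation o x o x
  flip : Reorientation o x (not o) (- x)

-- The contributions of one edge at v to out′ + in and to out + in′; under a flip both vanish.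
reorientation-exchange : ∀ {n} (p q v : Fin n) {o x o′ x′} → Reorientation o x o′ x′ →
  only-at (if o′ then p else q) v x′ + only-at (if o then q else p) v x
    ≡ only-at (if o then p else q) v x + only-at (if o′ then q else p) v x′
reorientation-exchange p q v keep = refl
reorientation-exchange p q v {true}  {x} flip =
  trans (only-at-inverseˡ q v x) (sym (only-at-inverseʳ p v x))
reorientation-exchange p q v {false} {x} flip =
  trans (only-at-inverseˡ p v x) (sym (only-at-inverseʳ q v x))

balanced-reorient : (G : Graph) {O O′ : Orientation G} {f f′ : Fin (m G) → ℤ} →
  (∀ e → Reorientation (O e) (f e) (O′ e) (f′ e)) → Balanced G O f → Balanced G O′ f′
balanced-reorient G {O} {O′} {f} {f′} reorient balanced v =
  ∙-cancelʳ (flowIn G O f v) _ _ (begin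
    flowOut G O′ f′ v + flowIn G O f v
      ≡⟨ sumℤ-pairwise (m G) (λ e →
           reorientation-exchange (proj₁ (ends G e)) (proj₂ (ends G e)) v (reorient e)) ⟩
    flowOut G O f v + flowIn G O′ f′ v
      ≡⟨ cong (_+ flowIn G O′ f′ v) (balanced v) ⟩
    flowIn G O f v + flowIn G O′ f′ v
      ≡⟨ ℤP.+-comm (flowIn G O f v) _ ⟩
    flowIn G O′ f′ v + flowIn G O f v ∎)
  where open ≡-Reasoning

indicator : ∀ {k} → (Fin k → Bool) → Fin k → ℤ
indicator C e = if C e then 1ℤ else 0ℤ

+-incidence : ∀ {n} c (u v : Fin n) →
  + (if c then (if ⌊ u ≟ v ⌋ then 1 else 0) else 0) ≡ only-at u v (if c then 1ℤ else 0ℤ)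
+-incidence false u v with u ≟ v
... | yes _ = refl
... | no  _ = refl
+-incidence true  u v with u ≟ v
... | yes _ = refl
... | no  _ = refl

+outdeg≡flowOut : ∀ G C O v → + outdeg G C O v ≡ flowOut G O (indicator C) v
+outdeg≡flowOut G C O v =
  trans (+-sumℕ (m G) _) (sumℤ-cong (m G) λ e → +-incidence (C e) (tail G O e) v)

+indeg≡flowIn : ∀ G C O v → + indeg G C O v ≡ flowIn G O (indicator C) v
+indeg≡flowIn G C O v =
  trans (+-sumℕ (m G) _) (sumℤ-cong (m G) λ e → +-incidence (C e) (head G O e) v)

edge-degree-split : ∀ {n} c o (p q v : Fin n) →
  (if c then (if ⌊ p ≟ v ⌋ then 1 else 0) ℕ.+ (if ⌊ q ≟ v ⌋ then 1 else 0) else 0)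
    ≡ (if c then (if ⌊ (if o then p else q) ≟ v ⌋ then 1 else 0) else 0)
      ℕ.+ (if c then (if ⌊ (if o then q else p) ≟ v ⌋ then 1 else 0) else 0)
edge-degree-split false o     p q v = refl
edge-degree-split true  true  p q v = refl
edge-degree-split true  false p q v = ℕP.+-comm (if ⌊ p ≟ v ⌋ then 1 else 0) _

degree≡outdeg+indeg : ∀ G C O v → degree G C v ≡ outdeg G C O v ℕ.+ indeg G C O v
degree≡outdeg+indeg G C O v =
  trans (sumℕ-cong (m G) λ e →
           edge-degree-split (C e) (O e) (proj₁ (ends G e)) (proj₂ (ends G e)) v)
        (sumℕ-distrib-+ (m G) _ _)

directedCycle⇒balanced : ∀ G {C O} → IsDirectedCycle G C O → Balanced G O (indicator C)
directedCycle⇒balanced G {C} {O} (_ , in≡out) v = begin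
  flowOut G O (indicator C) v ≡⟨ sym (+outdeg≡flowOut G C O v) ⟩
  + outdeg G C O v            ≡⟨ cong +_ (sym (in≡out v)) ⟩
  + indeg G C O v             ≡⟨ +indeg≡flowIn G C O v ⟩
  flowIn G O (indicator C) v  ∎
  where open ≡-Reasoning

balanced⇒directedCycle : ∀ G {C O} → Balanced G O (indicator C) → IsDirectedCycle G C O
balanced⇒directedCycle G {C} {O} balanced = even-degree , in≡out
  where
  in≡out : ∀ v → indeg G C O v ≡ outdeg G C O v
  in≡out v = ℤP.+-injective (begin
    + indeg G C O v             ≡⟨ +indeg≡flowIn G C O v ⟩
    flowIn G O (indicator C) v  ≡⟨ sym (balanced v) ⟩
    flowOut G O (indicator C) v ≡⟨ sym (+outdeg≡flowOut G C O v) ⟩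
    + outdeg G C O v            ∎)
    where open ≡-Reasoning
  even-degree : IsCycle G C
  even-degree v = outdeg G C O v ,
    trans (degree≡outdeg+indeg G C O v) (cong (outdeg G C O v ℕ.+_) (in≡out v))

isNonZero : ℤ → Bool
isNonZero (+ zero) = false
isNonZero _        = true

isOne : ℤ → Bool
isOne (+ 1) = true
isOne _     = false

unit-orientation : Bool → ℤ → Bool
unit-orientation o x = if isOne x then o else not o

unit-reorientation : ∀ o {x} → x ≡ 1ℤ ⊎ x ≡ -1ℤ ⊎ x ≡ 0ℤ →
  Reorientation o x (unit-orientation o x) (if isNonZero x then 1ℤ else 0ℤ)
unit-reorientation o (inj₁ refl)        = keep
unit-reorientation o (inj₂ (inj₁ refl)) = flip
unit-reorientation o (inj₂ (inj₂ refl)) = flip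

InH-coordinate : ∀ {d x} → InH d x → ∀ k → x k ≡ 1ℤ ⊎ x k ≡ -1ℤ ⊎ x k ≡ 0ℤ
InH-coordinate (i , j , _ , xi≡1 , xj≡-1 , rest) k with k ≟ i | k ≟ j
... | yes refl | _        = inj₁ xi≡1
... | no _     | yes refl = inj₂ (inj₁ xj≡-1)
... | no k≢i   | no k≢j   = inj₂ (inj₂ (rest k k≢i k≢j))

InH-support : ∀ {d x} (o : Bool) → InH d x → Σ (Fin d) λ i → Σ (Fin d) λ j →
  i ≢ j × T (isNonZero (x i)) × T (isNonZero (x j)) ×
  unit-orientation o (x i) ≡ not (unit-orientation o (x j)) ×
  (∀ k → T (isNonZero (x k)) → k ≡ i ⊎ k ≡ j)
InH-support {x = x} o (i , j , i≢j , xi≡1 , xj≡-1 , rest) =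
  i , j , i≢j , subst (T ∘ isNonZero) (sym xi≡1) _ , subst (T ∘ isNonZero) (sym xj≡-1) _ ,
  opposite , on-support
  where
  opposite : unit-orientation o (x i) ≡ not (unit-orientation o (x j))
  opposite rewrite xi≡1 | xj≡-1 = sym (not-involutive o)
  on-support : ∀ k → T (isNonZero (x k)) → k ≡ i ⊎ k ≡ j
  on-support k xk≢0 with k ≟ i | k ≟ j
  ... | yes k≡i | _       = inj₁ k≡i
  ... | no _    | yes k≡j = inj₂ k≡j
  ... | no k≢i  | no k≢j  = ⊥-elim (subst (T ∘ isNonZero) (rest k k≢i k≢j) xk≢0)

hflow⇒orientedCDC : ∀ {d} G → HFlow G d → OrientedCDC G d
hflow⇒orientedCDC G flow = record
  { C        = λ k e → isNonZero (φ e k)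
  ; O        = λ k e → unit-orientation (orient e) (φ e k)
  ; directed = λ k → balanced⇒directedCycle G (balanced-reorient G
      (λ e → unit-reorientation (orient e) (InH-coordinate (φ∈X e) k))
      (λ v → conserve v k))
  ; cover    = λ e → InH-support (orient e) (φ∈X e)
  }
  where open Flow flow

sgn : Bool → ℤ
sgn true  = 1ℤ
sgn false = -1ℤ

signed-support : Bool → Bool → ℤ
signed-support c o = if c then sgn o else 0ℤ

cycle-reorientation : ∀ c o →
  Reorientation o (if c then 1ℤ else 0ℤ) true (signed-support c o)
cycle-reorientation false true  = keep
cycle-reorientation false false = flip
cycle-reorientation true  true  = keep
cycle-reorientation true  false = flip

signed-support-on : ∀ {c} o → T c → signed-support c o ≡ sgn o
signed-support-on {true} o _ = refl

signed-support-off : ∀ {c} o → ¬ T c → signed-support c o ≡ 0ℤ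
signed-support-off {false} o _  = refl
signed-support-off {true}  o ¬c = ⊥-elim (¬c _)

double-cover⇒InH : ∀ {d} (c o : Fin d → Bool) {i j} → i ≢ j → T (c i) → T (c j) →
  o i ≡ not (o j) → (∀ k → T (c k) → k ≡ i ⊎ k ≡ j) →
  InH d (λ k → signed-support (c k) (o k))
double-cover⇒InH c o {i} {j} i≢j ci cj oi≡¬oj only with o j in oj≡
... | true  = j , i , i≢j ∘ sym ,
  trans (signed-support-on (o j) cj) (cong sgn oj≡) ,
  trans (signed-support-on (o i) ci) (cong sgn oi≡¬oj) ,
  λ k k≢j k≢i → signed-support-off (o k) ([ k≢i , k≢j ] ∘ only k)
... | false = i , j , i≢j ,
  trans (signed-support-on (o i) ci) (cong sgn oi≡¬oj) ,
  trans (signed-support-on (o j) cj) (cong sgn oj≡) ,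
  λ k k≢i k≢j → signed-support-off (o k) ([ k≢i , k≢j ] ∘ only k)

orientedCDC⇒hflow : ∀ {d} G → OrientedCDC G d → HFlow G d
orientedCDC⇒hflow G cdc = record
  { orient   = λ _ → true
  ; φ        = λ e k → signed-support (C k e) (O k e)
  ; φ∈X      = λ e → let (i , j , i≢j , ci , cj , oi≡¬oj , only) = cover e in
      double-cover⇒InH (λ k → C k e) (λ k → O k e) i≢j ci cj oi≡¬oj only
  ; conserve = λ v k → balanced-reorient G
      (λ e → cycle-reorientation (C k e) (O k e))
      (directedCycle⇒balanced G (directed k)) v
  }
  where open OrientedCDC cdc

theorem4 : (d : ℕ) → 3 ≤ d → (G : Graph) →
    (HFlow G d → OrientedCDC G d) × (OrientedCDC G d → HFlow G d)
theorem4 d _ G = hflow⇒orientedCDC G , orientedCDC⇒hflow G
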